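{- Let $d\ge 2$ and $n\ge 2$ be integers. Let $b_n^{(d)}$ be the number of loopless generalized chord diagrams with $n$ blocks of size $d$, and let $a_{m,k}^{(d)}$ be the number of generalized linear diagrams with $m$ blocks of size $d$ having exactly $k$ loops. Then $$ b_n^{(d)}=a_{n,0}^{(d)}-\sum_{k=0}^{d-2}\binom{d(n-1)-k-1}{d-2-k}\,a_{n-1,k}^{(d)}. $$
   Context: A generalized linear diagram with $m$ blocks of size $d$ is a partition of the set $\{1,2,\ldots,md\}$ (points on a line) into $m$ unordered blocks, each of size $d$ (each block is thought of as a complete graph $K_d$ on its points). A loop of a generalized linear diagram is a pair of consecutive points $\{i,i+1\}$, $1\le i<md$, lying in the same block. A generalized chord diagram with $n$ blocks of size $d$ is a partition of $\{1,\ldots,nd\}$ (points placed in this cyclic order on a circle) into $n$ blocks of size $d$; it is loopless if no two cyclically consecutive points (i.e. $i,i+1$ for $1\le i<nd$, and also $nd,1$) lie in the same block. Equivalently, $b_n^{(d)}$ counts loopless generalized chord diagrams, which encode Hamiltonian cycles in the complete $n$-partite graph $K_{d,\ldots,d}$. -}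

module Defs where

open import Data.Nat using (ℕ; zero; suc; _+_; _*_; _∸_; _≤ᵇ_; _≡ᵇ_)
open import Data.Bool using (Bool; true; false; _∧_; if_then_else_)
open import Data.List using (List; []; _∷_; length; filter; map; concatMap; upTo)
open import Data.Nat.ListAction using (sum)
open import Data.Nat.Combinatorics using (_C_)
open import Relation.Nullary.Decidable using (isYes)
open import Relation.Binary.PropositionalEquality using (_≡_)
open import Data.Bool.Properties using (T?)
open import Data.Integer using (ℤ; +_; _-_)

-- A set partition of the points {1,…,N} (written as positions 0,…,N-1)
-- into m unordered blocks is encoded canonically by its
-- restricted-growth word w = w₁…w_N : point i lies in block number wᵢ,
-- blocks being numbered 0,1,… in order of their first (smallest) point.

words : ℕ → ℕ → List (List ℕ)
words m zero    = [] ∷ []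
words m (suc L) = concatMap (λ x → map (x ∷_) (words m L)) (upTo m)

-- restricted growth: each letter is ≤ the number of distinct letters
-- seen so far (i.e. a new block gets the next unused number)
rgFrom : ℕ → List ℕ → Bool
rgFrom b []       = true
rgFrom b (x ∷ xs) = (x ≤ᵇ b) ∧ rgFrom (if x ≡ᵇ b then suc b else b) xs

isRG : List ℕ → Bool
isRG = rgFrom 0

occ : ℕ → List ℕ → ℕ
occ j w = length (filter (λ x → T? (j ≡ᵇ x)) w)

allB : (ℕ → Bool) → List ℕ → Bool
allB p []       = true
allB p (x ∷ xs) = p x ∧ allB p xs

allBlocksSize : ℕ → ℕ → List ℕ → Bool
allBlocksSize m d w = allB (λ j → occ j w ≡ᵇ d) (upTo m)

diagrams : ℕ → ℕ → List (List ℕ)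
diagrams m d = filter (λ w → T? (isRG w ∧ allBlocksSize m d w)) (words m (m * d))

loops : List ℕ → ℕ
loops []           = 0
loops (x ∷ [])     = 0
loops (x ∷ y ∷ xs) = (if x ≡ᵇ y then 1 else 0) + loops (y ∷ xs)

lastOr : ℕ → List ℕ → ℕ
lastOr a []       = a
lastOr a (x ∷ xs) = lastOr x xs

cyclicLoops : List ℕ → ℕ
cyclicLoops []       = 0
cyclicLoops (x ∷ xs) = loops (x ∷ xs) + (if lastOr x xs ≡ᵇ x then 1 else 0)

linearCount : ℕ → ℕ → ℕ → ℕ
linearCount d m k = length (filter (λ w → T? (loops w ≡ᵇ k)) (diagrams m d))

chordCount : ℕ → ℕ → ℕ
chordCount d n = length (filter (λ w → T? (cyclicLoops w ≡ᵇ 0)) (diagrams n d))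

correction : ℕ → ℕ → ℕ
correction d n =
  sum (map (λ k → ((d * (n ∸ 1) ∸ k ∸ 1) C (d ∸ 2 ∸ k)) * linearCount d (n ∸ 1) k)
           (upTo (d ∸ 1)))

-- A loopless linear diagram fails to be cyclically loopless exactly when its first and last
-- points lie in the same block.  Deleting that block from such a diagram with n blocks of
-- size d leaves a linear diagram w' with n - 1 blocks, and conversely the diagram is recovered
-- from w' by placing the deleted block at both ends and in d - 2 distinct gaps among the
-- d(n-1) - 1 inner gaps of w', every loop of w' being one of them.  If w' has k loops this
-- can be done in C(d(n-1) - k - 1, d - 2 - k) ways, so the correction term counts exactly the
-- loopless linear diagrams that are not cyclically loopless.

module Submission where

open import Algebra.Properties.CommutativeSemigroup using (interchange)
open import Data.Bool using (Bool; true; false; T; not; _∧_; if_then_else_)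
open import Data.Bool.Properties using (T?; T-∧)
open import Data.Empty using (⊥-elim)
open import Data.Integer using (+_; _-_; _⊖_)
import Data.Integer.Properties as ℤ
open import Data.List using (List; []; _∷_; _++_; length; filter; map; concatMap; upTo)
open import Data.List.Properties
  using (length-++; length-map; ∷-injectiveʳ; ++-cancelʳ; map-applyUpTo; map-upTo)
open import Data.List.Membership.Propositional using (_∈_; find; lose)
open import Data.List.Membership.Propositional.Properties
  using (∈-map⁺; ∈-map⁻; ∈-++⁺ˡ; ∈-++⁺ʳ; ∈-++⁻; ∈-concatMap⁺; ∈-concatMap⁻;
         ∈-filter⁺; ∈-filter⁻; ∈-upTo⁺; ∈-upTo⁻)
open import Data.List.Membership.Propositional.Properties.WithK using (unique∧set⇒bag)
open import Data.List.Relation.Binary.BagAndSetEquality using (∼bag⇒↭)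
open import Data.List.Relation.Binary.Disjoint.Propositional using (Disjoint)
open import Data.List.Relation.Binary.Permutation.Propositional.Properties using (↭-length)
open import Data.List.Relation.Unary.All as All using (All; []; _∷_)
import Data.List.Relation.Unary.All.Properties as All
open import Data.List.Relation.Unary.AllPairs as AllPairs using ([]; _∷_)
import Data.List.Relation.Unary.AllPairs.Properties as AllPairs
open import Data.List.Relation.Unary.Any using (here; there)
open import Data.List.Relation.Unary.Unique.Propositional using (Unique)
import Data.List.Relation.Unary.Unique.Propositional.Properties as Unique
open import Data.Nat using (ℕ; zero; suc; _+_; _*_; _∸_; _≤_; _<_; _≤ᵇ_; _≡ᵇ_; _<ᵇ_; z≤n; s≤s; s≤s⁻¹)
open import Data.Nat.Combinatorics using (_C_; nCk+nC[k+1]≡[n+1]C[k+1])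
open import Data.Nat.ListAction using (sum)
open import Data.Nat.Properties
open import Data.Product using (∃; _×_; _,_)
open import Data.Sum using (_⊎_; inj₁; inj₂)
open import Data.Unit using (tt)
open import Function using (_∘_)
open import Function.Bundles using (mk⇔; Equivalence)
open import Relation.Binary.PropositionalEquality

open import Defs

private
  variable
    A : Set

count : (A → Bool) → List A → ℕ
count p xs = length (filter (λ x → T? (p x)) xs)

indicator : Bool → ℕ
indicator b = if b then 1 else 0

count-∷ : (p : A → Bool) (x : A) (xs : List A) → count p (x ∷ xs) ≡ indicator (p x) + count p xs
count-∷ p x xs with p x
... | true  = refl
... | false = refl

count-split : (p r : A → Bool) → (∀ x → T (r x) → T (p x)) → (xs : List A) →
  count p xs ≡ count r xs + count (λ x → p x ∧ not (r x)) xs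
count-split p r r⇒p [] = refl
count-split p r r⇒p (x ∷ xs)
  rewrite count-∷ p x xs | count-∷ r x xs | count-∷ (λ x → p x ∧ not (r x)) x xs
        | count-split p r r⇒p xs
  with r x in rx | p x in px
... | true  | true  = refl
... | true  | false = ⊥-elim (subst T px (r⇒p x (subst T (sym rx) tt)))
... | false | true  = sym (+-suc (count r xs) _)
... | false | false = refl

sum-map-+ : (f g : A → ℕ) (xs : List A) →
  sum (map (λ x → f x + g x) xs) ≡ sum (map f xs) + sum (map g xs)
sum-map-+ f g []       = refl
sum-map-+ f g (x ∷ xs) =
  trans (cong (_+_ (f x + g x)) (sum-map-+ f g xs))
        (interchange +-commutativeSemigroup (f x) (g x) (sum (map f xs)) (sum (map g xs)))

sum-map-cong : (f g : A → ℕ) (xs : List A) → (∀ x → x ∈ xs → f x ≡ g x) →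
  sum (map f xs) ≡ sum (map g xs)
sum-map-cong f g []       f≡g = refl
sum-map-cong f g (x ∷ xs) f≡g =
  cong₂ _+_ (f≡g x (here refl)) (sum-map-cong f g xs (λ y y∈ → f≡g y (there y∈)))

sum-map-zero : (xs : List A) → sum (map (λ _ → 0) xs) ≡ 0
sum-map-zero []       = refl
sum-map-zero (x ∷ xs) = sum-map-zero xs

sum-map-*0 : (c : ℕ → ℕ) (xs : List ℕ) → sum (map (λ k → c k * 0) xs) ≡ 0
sum-map-*0 c xs = trans (sum-map-cong _ _ xs (λ k _ → *-zeroʳ (c k))) (sum-map-zero xs)

sum-map-upTo-suc : (f : ℕ → ℕ) (K : ℕ) →
  sum (map f (upTo (suc K))) ≡ f 0 + sum (map (f ∘ suc) (upTo K))
sum-map-upTo-suc f K =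
  cong (λ xs → f 0 + sum xs) (trans (map-applyUpTo suc f K) (sym (map-upTo (f ∘ suc) K)))

sum-indicator : (c : ℕ → ℕ) (x K : ℕ) →
  sum (map (λ k → c k * indicator (x ≡ᵇ k)) (upTo K)) ≡ (if x <ᵇ K then c x else 0)
sum-indicator c zero    zero    = refl
sum-indicator c (suc x) zero    = refl
sum-indicator c zero    (suc K) =
  trans (sum-map-upTo-suc _ K)
        (trans (cong₂ _+_ (*-identityʳ (c 0)) (sum-map-*0 (c ∘ suc) (upTo K))) (+-identityʳ (c 0)))
sum-indicator c (suc x) (suc K) =
  trans (sum-map-upTo-suc _ K) (cong₂ _+_ (*-zeroʳ (c 0)) (sum-indicator (c ∘ suc) x K))

sum-by-value : (c : ℕ → ℕ) (κ : A → ℕ) (K : ℕ) (xs : List A) →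
  sum (map (λ k → c k * count (λ x → κ x ≡ᵇ k) xs) (upTo K)) ≡
  sum (map (λ x → if κ x <ᵇ K then c (κ x) else 0) xs)
sum-by-value c κ K []       = sum-map-*0 c (upTo K)
sum-by-value c κ K (x ∷ xs) = begin
    sum (map (λ k → c k * count (λ y → κ y ≡ᵇ k) (x ∷ xs)) (upTo K))
  ≡⟨ sum-map-cong _ _ (upTo K) (λ k _ →
       trans (cong (c k *_) (count-∷ (λ y → κ y ≡ᵇ k) x xs)) (*-distribˡ-+ (c k) _ _)) ⟩
    sum (map (λ k → c k * indicator (κ x ≡ᵇ k) + c k * count (λ y → κ y ≡ᵇ k) xs) (upTo K))
  ≡⟨ sum-map-+ _ _ (upTo K) ⟩
    sum (map (λ k → c k * indicator (κ x ≡ᵇ k)) (upTo K))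
      + sum (map (λ k → c k * count (λ y → κ y ≡ᵇ k) xs) (upTo K))
  ≡⟨ cong₂ _+_ (sum-indicator c (κ x) K) (sum-by-value c κ K xs) ⟩
    (if κ x <ᵇ K then c (κ x) else 0) + sum (map (λ y → if κ y <ᵇ K then c (κ y) else 0) xs)
  ∎
  where open ≡-Reasoning

length-concatMap : {B : Set} (f : A → List B) (xs : List A) →
  length (concatMap f xs) ≡ sum (map (length ∘ f) xs)
length-concatMap f []       = refl
length-concatMap f (x ∷ xs) = trans (length-++ (f x)) (cong (_+_ (length (f x))) (length-concatMap f xs))

unique-length-≡ : {xs ys : List A} → Unique xs → Unique ys →
  (∀ {z} → z ∈ xs → z ∈ ys) → (∀ {z} → z ∈ ys → z ∈ xs) → length xs ≡ length ys
unique-length-≡ uxs uys xs⊆ys ys⊆xs = ↭-length (∼bag⇒↭ (unique∧set⇒bag uxs uys (mk⇔ xs⊆ys ys⊆xs)))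

concatMap-unique : {B : Set} (f : A → List B) (g : B → A) →
  (∀ {x y} → y ∈ f x → g y ≡ x) → (∀ x → Unique (f x)) →
  (xs : List A) → Unique xs → Unique (concatMap f xs)
concatMap-unique f g g-inv f-unique xs uxs =
  Unique.concat⁺ (All.map⁺ (All.tabulate (λ {x} _ → f-unique x)))
                 (AllPairs.map⁺ (AllPairs.map disjoint uxs))
  where
  disjoint : ∀ {x y} → x ≢ y → Disjoint (f x) (f y)
  disjoint x≢y (z∈fx , z∈fy) = x≢y (trans (sym (g-inv z∈fx)) (g-inv z∈fy))

∈-words⁻ : ∀ m L {w} → w ∈ words m L → length w ≡ L × All (_< m) w
∈-words⁻ m zero    (here refl) = refl , []
∈-words⁻ m (suc L) w∈ with find (∈-concatMap⁻ (λ x → map (x ∷_) (words m L)) {xs = upTo m} w∈)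
... | x , x∈ , xw∈ with ∈-map⁻ (x ∷_) xw∈
... | w , w∈ , refl with ∈-words⁻ m L w∈
... | length≡ , bounded = cong suc length≡ , ∈-upTo⁻ x∈ ∷ bounded

∈-words⁺ : ∀ m {w} → All (_< m) w → w ∈ words m (length w)
∈-words⁺ m {[]}    []            = here refl
∈-words⁺ m {x ∷ w} (x<m ∷ w<m) =
  ∈-concatMap⁺ (λ y → map (y ∷_) (words m (length w))) {xs = upTo m}
    (lose (∈-upTo⁺ x<m) (∈-map⁺ (x ∷_) (∈-words⁺ m w<m)))

words-unique : ∀ m L → Unique (words m L)
words-unique m zero    = [] ∷ []
words-unique m (suc L) =
  concatMap-unique (λ x → map (x ∷_) (words m L)) head-of head-of-∈
    (λ x → Unique.map⁺ ∷-injectiveʳ (words-unique m L)) (upTo m) (Unique.upTo⁺ m)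
  where
  head-of : List ℕ → ℕ
  head-of []      = 0
  head-of (x ∷ _) = x
  head-of-∈ : ∀ {x w} → w ∈ map (x ∷_) (words m L) → head-of w ≡ x
  head-of-∈ w∈ with ∈-map⁻ _ w∈
  ... | _ , _ , refl = refl

record IsDiagram (m d : ℕ) (w : List ℕ) : Set where
  field
    length≡ : length w ≡ m * d
    bounded : All (_< m) w
    valid   : T (isRG w ∧ allBlocksSize m d w)

∈-diagrams⁻ : ∀ m d {w} → w ∈ diagrams m d → IsDiagram m d w
∈-diagrams⁻ m d w∈ with ∈-filter⁻ (λ w → T? (isRG w ∧ allBlocksSize m d w)) {xs = words m (m * d)} w∈
... | w∈words , valid with ∈-words⁻ m (m * d) w∈words
... | length≡ , bounded = record { length≡ = length≡ ; bounded = bounded ; valid = valid }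

∈-diagrams⁺ : ∀ m d {w} → IsDiagram m d w → w ∈ diagrams m d
∈-diagrams⁺ m d {w} D = ∈-filter⁺ (λ w → T? (isRG w ∧ allBlocksSize m d w))
  (subst (λ L → w ∈ words m L) (IsDiagram.length≡ D) (∈-words⁺ m (IsDiagram.bounded D)))
  (IsDiagram.valid D)

diagrams-unique : ∀ m d → Unique (diagrams m d)
diagrams-unique m d = Unique.filter⁺ _ (words-unique m (m * d))

-- Deleting the block of the first point

deleteBlock₀ : List ℕ → List ℕ
deleteBlock₀ []          = []
deleteBlock₀ (zero ∷ w)  = deleteBlock₀ w
deleteBlock₀ (suc x ∷ w) = x ∷ deleteBlock₀ w

length-deleteBlock₀ : ∀ w → length w ≡ occ 0 w + length (deleteBlock₀ w)
length-deleteBlock₀ []          = refl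
length-deleteBlock₀ (zero ∷ w)  = cong suc (length-deleteBlock₀ w)
length-deleteBlock₀ (suc x ∷ w) = trans (cong suc (length-deleteBlock₀ w)) (sym (+-suc (occ 0 w) _))

occ-deleteBlock₀ : ∀ j w → occ (suc j) w ≡ occ j (deleteBlock₀ w)
occ-deleteBlock₀ j []          = refl
occ-deleteBlock₀ j (zero ∷ w)  = occ-deleteBlock₀ j w
occ-deleteBlock₀ j (suc x ∷ w) = begin
    occ (suc j) (suc x ∷ w)                   ≡⟨ count-∷ (suc j ≡ᵇ_) (suc x) w ⟩
    indicator (j ≡ᵇ x) + occ (suc j) w        ≡⟨ cong (_+_ (indicator (j ≡ᵇ x))) (occ-deleteBlock₀ j w) ⟩
    indicator (j ≡ᵇ x) + occ j (deleteBlock₀ w) ≡⟨ count-∷ (j ≡ᵇ_) x (deleteBlock₀ w) ⟨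
    occ j (x ∷ deleteBlock₀ w)                ∎
  where open ≡-Reasoning

suc≤ᵇsuc : ∀ x b → (suc x ≤ᵇ suc b) ≡ (x ≤ᵇ b)
suc≤ᵇsuc zero    b = refl
suc≤ᵇsuc (suc x) b = refl

rgFrom-deleteBlock₀ : ∀ b w → rgFrom (suc b) w ≡ rgFrom b (deleteBlock₀ w)
rgFrom-deleteBlock₀ b []          = refl
rgFrom-deleteBlock₀ b (zero ∷ w)  = rgFrom-deleteBlock₀ b w
rgFrom-deleteBlock₀ b (suc x ∷ w) with x ≡ᵇ b
... | true  = cong₂ _∧_ (suc≤ᵇsuc x b) (rgFrom-deleteBlock₀ (suc b) w)
... | false = cong₂ _∧_ (suc≤ᵇsuc x b) (rgFrom-deleteBlock₀ b w)

deleteBlock₀-bounded⁺ : ∀ m w → All (_< suc m) w → All (_< m) (deleteBlock₀ w)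
deleteBlock₀-bounded⁺ m []          []              = []
deleteBlock₀-bounded⁺ m (zero ∷ w)  (_ ∷ w<)        = deleteBlock₀-bounded⁺ m w w<
deleteBlock₀-bounded⁺ m (suc x ∷ w) (s≤s x<m ∷ w<) = x<m ∷ deleteBlock₀-bounded⁺ m w w<

deleteBlock₀-bounded⁻ : ∀ m w → All (_< m) (deleteBlock₀ w) → All (_< suc m) w
deleteBlock₀-bounded⁻ m []          _            = []
deleteBlock₀-bounded⁻ m (zero ∷ w)  w<           = s≤s z≤n ∷ deleteBlock₀-bounded⁻ m w w<
deleteBlock₀-bounded⁻ m (suc x ∷ w) (x<m ∷ w<) = s≤s x<m ∷ deleteBlock₀-bounded⁻ m w w<

deleteBlock₀-∷ʳ0 : ∀ t → deleteBlock₀ (t ++ 0 ∷ []) ≡ deleteBlock₀ t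
deleteBlock₀-∷ʳ0 []          = refl
deleteBlock₀-∷ʳ0 (zero ∷ t)  = deleteBlock₀-∷ʳ0 t
deleteBlock₀-∷ʳ0 (suc x ∷ t) = cong (x ∷_) (deleteBlock₀-∷ʳ0 t)

occ₀-∷ʳ0 : ∀ t → occ 0 (t ++ 0 ∷ []) ≡ suc (occ 0 t)
occ₀-∷ʳ0 []          = refl
occ₀-∷ʳ0 (zero ∷ t)  = cong suc (occ₀-∷ʳ0 t)
occ₀-∷ʳ0 (suc x ∷ t) = occ₀-∷ʳ0 t

allB-map-suc : ∀ (p : ℕ → Bool) xs → allB p (map suc xs) ≡ allB (p ∘ suc) xs
allB-map-suc p []       = refl
allB-map-suc p (x ∷ xs) = cong (p (suc x) ∧_) (allB-map-suc p xs)

allB-cong : ∀ (p q : ℕ → Bool) xs → (∀ x → p x ≡ q x) → allB p xs ≡ allB q xs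
allB-cong p q []       p≡q = refl
allB-cong p q (x ∷ xs) p≡q = cong₂ _∧_ (p≡q x) (allB-cong p q xs p≡q)

allBlocksSize-suc : ∀ m d w →
  allBlocksSize (suc m) d w ≡ (occ 0 w ≡ᵇ d) ∧ allBlocksSize m d (deleteBlock₀ w)
allBlocksSize-suc m d w = begin
    allB (λ j → occ j w ≡ᵇ d) (upTo (suc m))
      ≡⟨ cong (allB (λ j → occ j w ≡ᵇ d) ∘ (0 ∷_)) (map-upTo suc m) ⟨
    allB (λ j → occ j w ≡ᵇ d) (0 ∷ map suc (upTo m))
      ≡⟨ cong ((occ 0 w ≡ᵇ d) ∧_) (allB-map-suc (λ j → occ j w ≡ᵇ d) (upTo m)) ⟩
    (occ 0 w ≡ᵇ d) ∧ allB (λ j → occ (suc j) w ≡ᵇ d) (upTo m)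
      ≡⟨ cong ((occ 0 w ≡ᵇ d) ∧_) (allB-cong _ _ (upTo m) (λ j → cong (_≡ᵇ d) (occ-deleteBlock₀ j w))) ⟩
    (occ 0 w ≡ᵇ d) ∧ allBlocksSize m d (deleteBlock₀ w)
      ∎
  where open ≡-Reasoning

valid-0∷ : ∀ m d r →
  (isRG (0 ∷ r) ∧ allBlocksSize (suc m) d (0 ∷ r)) ≡
  (isRG (deleteBlock₀ r) ∧ ((suc (occ 0 r) ≡ᵇ d) ∧ allBlocksSize m d (deleteBlock₀ r)))
valid-0∷ m d r = cong₂ _∧_ (rgFrom-deleteBlock₀ 0 r) (allBlocksSize-suc m d (0 ∷ r))

isDiagram-deleteBlock₀ : ∀ m d r → IsDiagram (suc m) d (0 ∷ r) →
  IsDiagram m d (deleteBlock₀ r) × suc (occ 0 r) ≡ d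
isDiagram-deleteBlock₀ m d r D
  with Equivalence.to (T-∧ {isRG (deleteBlock₀ r)}) (subst T (valid-0∷ m d r) (IsDiagram.valid D))
... | rg , size₀×blocks with Equivalence.to (T-∧ {suc (occ 0 r) ≡ᵇ d}) size₀×blocks
... | size₀ᵇ , blocks = record
  { length≡ = +-cancelˡ-≡ d _ _ length≡
  ; bounded = deleteBlock₀-bounded⁺ m r (All.tail (IsDiagram.bounded D))
  ; valid   = Equivalence.from T-∧ (rg , blocks)
  } , size₀
  where
  open ≡-Reasoning
  size₀ : suc (occ 0 r) ≡ d
  size₀ = ≡ᵇ⇒≡ _ _ size₀ᵇ
  length≡ : d + length (deleteBlock₀ r) ≡ d + m * d
  length≡ = begin
    d + length (deleteBlock₀ r)                ≡⟨ cong (_+ length (deleteBlock₀ r)) size₀ ⟨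
    suc (occ 0 r + length (deleteBlock₀ r))    ≡⟨ cong suc (length-deleteBlock₀ r) ⟨
    length (0 ∷ r)                             ≡⟨ IsDiagram.length≡ D ⟩
    d + m * d                                  ∎

isDiagram-insertBlock₀ : ∀ m d r → IsDiagram m d (deleteBlock₀ r) → suc (occ 0 r) ≡ d →
  IsDiagram (suc m) d (0 ∷ r)
isDiagram-insertBlock₀ m d r D size₀
  with Equivalence.to (T-∧ {isRG (deleteBlock₀ r)}) (IsDiagram.valid D)
... | rg , blocks = record
  { length≡ = trans (cong suc (length-deleteBlock₀ r)) (cong₂ _+_ size₀ (IsDiagram.length≡ D))
  ; bounded = s≤s z≤n ∷ deleteBlock₀-bounded⁻ m r (IsDiagram.bounded D)
  ; valid   = subst T (sym (valid-0∷ m d r))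
                (Equivalence.from T-∧ (rg , Equivalence.from T-∧ (≡⇒≡ᵇ _ _ size₀ , blocks)))
  }

-- Placing the points of block 0 into the gaps of a word

-- gapFillings p j ys lists the words t with deleteBlock₀ t ≡ ys, j zeros and no loop in
-- suc p ∷ t ++ 0 ∷ []: each zero takes its own gap between consecutive letters of p ∷ ys,
-- and every gap between two equal letters must receive one.
mutual
  gapFillings : ℕ → ℕ → List ℕ → List (List ℕ)
  gapFillings p j       (y ∷ ys) = fillingsBefore (p ≡ᵇ y) y j ys
  gapFillings p zero    []       = [] ∷ []
  gapFillings p (suc j) []       = []

  fillingsBefore : Bool → ℕ → ℕ → List ℕ → List (List ℕ)
  fillingsBefore true  y j ys = filledGapBefore y j ys
  fillingsBefore false y j ys = map (suc y ∷_) (gapFillings y j ys) ++ filledGapBefore y j ys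

  filledGapBefore : ℕ → ℕ → List ℕ → List (List ℕ)
  filledGapBefore y zero    ys = []
  filledGapBefore y (suc j) ys = map (λ t → 0 ∷ suc y ∷ t) (gapFillings y j ys)

record IsGapFilling (p j : ℕ) (ys t : List ℕ) : Set where
  field
    deletes  : deleteBlock₀ t ≡ ys
    zeros    : occ 0 t ≡ j
    loopless : loops (suc p ∷ t ++ 0 ∷ []) ≡ 0

mutual
  ∈-gapFillings⁻ : ∀ p j ys {t} → t ∈ gapFillings p j ys → IsGapFilling p j ys t
  ∈-gapFillings⁻ p j (y ∷ ys) t∈ with p ≡ᵇ y in p≡ᵇy
  ... | true  = ∈-filledGapBefore⁻ p y j ys t∈
  ... | false with ∈-++⁻ (map (suc y ∷_) (gapFillings y j ys)) t∈
  ...   | inj₂ t∈filled = ∈-filledGapBefore⁻ p y j ys t∈filled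
  ...   | inj₁ t∈open with ∈-map⁻ (suc y ∷_) t∈open
  ...     | t , t∈ , refl = record
    { deletes  = cong (y ∷_) deletes
    ; zeros    = zeros
    ; loopless = subst (λ b → indicator b + loops (suc y ∷ t ++ 0 ∷ []) ≡ 0) (sym p≡ᵇy) loopless
    }
    where open IsGapFilling (∈-gapFillings⁻ y j ys t∈)
  ∈-gapFillings⁻ p zero [] (here refl) = record { deletes = refl ; zeros = refl ; loopless = refl }

  ∈-filledGapBefore⁻ : ∀ p y j ys {t} → t ∈ filledGapBefore y j ys → IsGapFilling p j (y ∷ ys) t
  ∈-filledGapBefore⁻ p y (suc j) ys t∈ with ∈-map⁻ (λ t → 0 ∷ suc y ∷ t) t∈
  ... | t , t∈ , refl = record
    { deletes  = cong (y ∷_) deletes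
    ; zeros    = cong suc zeros
    ; loopless = loopless
    }
    where open IsGapFilling (∈-gapFillings⁻ y j ys t∈)

filledGapBefore⊆fillingsBefore : ∀ b y j ys {t} →
  t ∈ filledGapBefore y j ys → t ∈ fillingsBefore b y j ys
filledGapBefore⊆fillingsBefore true  y j ys t∈ = t∈
filledGapBefore⊆fillingsBefore false y j ys t∈ = ∈-++⁺ʳ (map (suc y ∷_) (gapFillings y j ys)) t∈

∈-gapFillings⁺ : ∀ p t → loops (suc p ∷ t ++ 0 ∷ []) ≡ 0 → t ∈ gapFillings p (occ 0 t) (deleteBlock₀ t)
∈-gapFillings⁺ p []                  loopless = here refl
∈-gapFillings⁺ p (zero ∷ suc y ∷ t) loopless =
  filledGapBefore⊆fillingsBefore (p ≡ᵇ y) y _ _ (∈-map⁺ (λ t → 0 ∷ suc y ∷ t) (∈-gapFillings⁺ y t loopless))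
∈-gapFillings⁺ p (suc y ∷ t)        loopless with p ≡ᵇ y
... | false = ∈-++⁺ˡ (∈-map⁺ (suc y ∷_) (∈-gapFillings⁺ y t loopless))

mutual
  gapFillings-unique : ∀ p j ys → Unique (gapFillings p j ys)
  gapFillings-unique p j       (y ∷ ys) = fillingsBefore-unique (p ≡ᵇ y) y j ys
  gapFillings-unique p zero    []       = [] ∷ []
  gapFillings-unique p (suc j) []       = []

  fillingsBefore-unique : ∀ b y j ys → Unique (fillingsBefore b y j ys)
  fillingsBefore-unique true  y j ys = filledGapBefore-unique y j ys
  fillingsBefore-unique false y j ys =
    Unique.++⁺ (Unique.map⁺ ∷-injectiveʳ (gapFillings-unique y j ys)) (filledGapBefore-unique y j ys)
               (disjoint j)
    where
    disjoint : ∀ j → Disjoint (map (suc y ∷_) (gapFillings y j ys)) (filledGapBefore y j ys)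
    disjoint (suc j) (t∈open , t∈filled) with ∈-map⁻ (suc y ∷_) t∈open | ∈-map⁻ _ t∈filled
    ... | _ , _ , refl | _ , _ , ()

  filledGapBefore-unique : ∀ y j ys → Unique (filledGapBefore y j ys)
  filledGapBefore-unique y zero    ys = []
  filledGapBefore-unique y (suc j) ys =
    Unique.map⁺ (∷-injectiveʳ ∘ ∷-injectiveʳ) (gapFillings-unique y j ys)

loops-≤-length : ∀ p ys → loops (p ∷ ys) ≤ length ys
loops-≤-length p []       = z≤n
loops-≤-length p (y ∷ ys) with p ≡ᵇ y
... | true  = s≤s (loops-≤-length y ys)
... | false = m≤n⇒m≤1+n (loops-≤-length y ys)

mutual
  length-gapFillings-< : ∀ p j ys → j < loops (p ∷ ys) → length (gapFillings p j ys) ≡ 0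
  length-gapFillings-< p j (y ∷ ys) j<loops with p ≡ᵇ y
  ... | true  = length-filledGapBefore-≤ y j ys (s≤s⁻¹ j<loops)
  ... | false = begin
      length (map (suc y ∷_) (gapFillings y j ys) ++ filledGapBefore y j ys)
        ≡⟨ length-++ (map (suc y ∷_) (gapFillings y j ys)) ⟩
      length (map (suc y ∷_) (gapFillings y j ys)) + length (filledGapBefore y j ys)
        ≡⟨ cong₂ _+_ (trans (length-map _ (gapFillings y j ys)) (length-gapFillings-< y j ys j<loops))
                     (length-filledGapBefore-≤ y j ys (<⇒≤ j<loops)) ⟩
      0 ∎
    where open ≡-Reasoning

  length-filledGapBefore-≤ : ∀ y j ys → j ≤ loops (y ∷ ys) → length (filledGapBefore y j ys) ≡ 0
  length-filledGapBefore-≤ y zero    ys _         = refl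
  length-filledGapBefore-≤ y (suc j) ys j<loops =
    trans (length-map _ (gapFillings y j ys)) (length-gapFillings-< y j ys j<loops)

-- The loops of p ∷ ys are forced gaps; the other t zeros choose among the remaining gaps.
mutual
  length-gapFillings : ∀ p t ys →
    length (gapFillings p (loops (p ∷ ys) + t) ys) ≡ (length ys ∸ loops (p ∷ ys)) C t
  length-gapFillings p zero    []       = refl
  length-gapFillings p (suc t) []       = refl
  length-gapFillings p t       (y ∷ ys) with p ≡ᵇ y
  ... | true  = length-filledGapBefore y t ys
  ... | false = begin
      length (map (suc y ∷_) (gapFillings y (ℓ + t) ys) ++ filledGapBefore y (ℓ + t) ys)
        ≡⟨ length-++ (map (suc y ∷_) (gapFillings y (ℓ + t) ys)) ⟩
      length (map (suc y ∷_) (gapFillings y (ℓ + t) ys)) + length (filledGapBefore y (ℓ + t) ys)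
        ≡⟨ cong (_+ length (filledGapBefore y (ℓ + t) ys))
                (trans (length-map _ (gapFillings y (ℓ + t) ys)) (length-gapFillings y t ys)) ⟩
      (length ys ∸ ℓ) C t + length (filledGapBefore y (ℓ + t) ys)
        ≡⟨ pascal t ⟩
      suc (length ys ∸ ℓ) C t
        ≡⟨ cong (_C t) (+-∸-assoc 1 (loops-≤-length y ys)) ⟨
      (suc (length ys) ∸ ℓ) C t ∎
    where
    open ≡-Reasoning
    ℓ : ℕ
    ℓ = loops (y ∷ ys)
    pascal : ∀ t → (length ys ∸ ℓ) C t + length (filledGapBefore y (ℓ + t) ys) ≡ suc (length ys ∸ ℓ) C t
    pascal zero    rewrite +-identityʳ ℓ =
      cong (_+_ ((length ys ∸ ℓ) C 0)) (length-filledGapBefore-≤ y ℓ ys ≤-refl)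
    pascal (suc t) rewrite +-suc ℓ t = begin
      (length ys ∸ ℓ) C suc t + length (filledGapBefore y (suc (ℓ + t)) ys)
        ≡⟨ cong (_+_ ((length ys ∸ ℓ) C suc t)) (length-filledGapBefore y t ys) ⟩
      (length ys ∸ ℓ) C suc t + (length ys ∸ ℓ) C t
        ≡⟨ +-comm ((length ys ∸ ℓ) C suc t) _ ⟩
      (length ys ∸ ℓ) C t + (length ys ∸ ℓ) C suc t
        ≡⟨ nCk+nC[k+1]≡[n+1]C[k+1] (length ys ∸ ℓ) t ⟩
      suc (length ys ∸ ℓ) C suc t ∎

  length-filledGapBefore : ∀ y t ys →
    length (filledGapBefore y (suc (loops (y ∷ ys) + t)) ys) ≡ (length ys ∸ loops (y ∷ ys)) C t
  length-filledGapBefore y t ys =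
    trans (length-map _ (gapFillings y (loops (y ∷ ys) + t) ys)) (length-gapFillings y t ys)

-- Loopless linear diagrams whose first and last points share a block

wrapsAround : List ℕ → Bool
wrapsAround w = (loops w ≡ᵇ 0) ∧ not (cyclicLoops w ≡ᵇ 0)

wrappings : ℕ → List ℕ → List (List ℕ)
wrappings k []       = []
wrappings k (x ∷ ys) = map (λ t → 0 ∷ suc x ∷ t ++ 0 ∷ []) (gapFillings x k ys)

wrapsAround⁻ : ∀ L b → T ((L ≡ᵇ 0) ∧ not ((L + indicator b) ≡ᵇ 0)) → L ≡ 0 × b ≡ true
wrapsAround⁻ zero true _ = refl , refl

lastOr-∷ʳ : ∀ a t y → lastOr a (t ++ y ∷ []) ≡ y
lastOr-∷ʳ a []      y = refl
lastOr-∷ʳ a (x ∷ t) y = lastOr-∷ʳ x t y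

lastOr-≡ : ∀ a xs {c} → lastOr a xs ≡ c → (xs ≡ [] × a ≡ c) ⊎ ∃ λ t → xs ≡ t ++ c ∷ []
lastOr-≡ a []       a≡c = inj₁ (refl , a≡c)
lastOr-≡ a (x ∷ xs) last≡c with lastOr-≡ x xs last≡c
... | inj₁ (refl , refl) = inj₂ ([] , refl)
... | inj₂ (t , refl)    = inj₂ (x ∷ t , refl)

∈-wrappings⁺ : ∀ k m {w} → IsDiagram (suc m) (2 + k) w → T (wrapsAround w) →
  w ∈ concatMap (wrappings k) (diagrams m (2 + k))
∈-wrappings⁺ k m {[]}    D _ with IsDiagram.length≡ D
... | ()
∈-wrappings⁺ k m {suc a ∷ r} D _ with IsDiagram.valid D
... | ()
∈-wrappings⁺ k m {zero ∷ []} D _ with IsDiagram.length≡ D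
... | ()
∈-wrappings⁺ k m {zero ∷ suc x ∷ r} D wraps
  with wrapsAround⁻ (loops (suc x ∷ r)) (lastOr (suc x) r ≡ᵇ 0) wraps
... | loopless , closes with lastOr-≡ (suc x) r (≡ᵇ⇒≡ _ _ (subst T (sym closes) tt))
... | inj₂ (t , refl) with isDiagram-deleteBlock₀ m (2 + k) (suc x ∷ t ++ 0 ∷ []) D
... | D' , size₀ =
  ∈-concatMap⁺ (wrappings k) {xs = diagrams m (2 + k)}
    (lose (∈-diagrams⁺ m (2 + k) (subst (IsDiagram m (2 + k) ∘ (x ∷_)) (deleteBlock₀-∷ʳ0 t) D'))
          (∈-map⁺ (λ t → 0 ∷ suc x ∷ t ++ 0 ∷ []) t∈))
  where
  zeros : occ 0 t ≡ k
  zeros = suc-injective (suc-injective (trans (cong suc (sym (occ₀-∷ʳ0 t))) size₀))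
  t∈ : t ∈ gapFillings x k (deleteBlock₀ t)
  t∈ = subst (λ j → t ∈ gapFillings x j (deleteBlock₀ t)) zeros (∈-gapFillings⁺ x t loopless)

∈-wrappings⁻ : ∀ k m {w' v} → IsDiagram m (2 + k) w' → v ∈ wrappings k w' →
  IsDiagram (suc m) (2 + k) v × T (wrapsAround v)
∈-wrappings⁻ k m {x ∷ ys} D v∈ with ∈-map⁻ (λ t → 0 ∷ suc x ∷ t ++ 0 ∷ []) v∈
... | t , t∈ , refl =
  isDiagram-insertBlock₀ m (2 + k) (suc x ∷ t ++ 0 ∷ [])
    (subst (IsDiagram m (2 + k) ∘ (x ∷_)) (sym (trans (deleteBlock₀-∷ʳ0 t) deletes)) D)
    (cong suc (trans (occ₀-∷ʳ0 t) (cong suc zeros)))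
  , wraps loopless (lastOr-∷ʳ (suc x) t 0)
  where
  open IsGapFilling (∈-gapFillings⁻ x k ys t∈)
  wraps : ∀ {L e} → L ≡ 0 → e ≡ 0 → T ((L ≡ᵇ 0) ∧ not ((L + indicator (e ≡ᵇ 0)) ≡ᵇ 0))
  wraps refl refl = tt

deleteBlock₀-wrappings : ∀ k w' {v} → v ∈ wrappings k w' → deleteBlock₀ v ≡ w'
deleteBlock₀-wrappings k (x ∷ ys) v∈ with ∈-map⁻ (λ t → 0 ∷ suc x ∷ t ++ 0 ∷ []) v∈
... | t , t∈ , refl = cong (x ∷_) (trans (deleteBlock₀-∷ʳ0 t) (IsGapFilling.deletes (∈-gapFillings⁻ x k ys t∈)))

wrappings-unique : ∀ k w' → Unique (wrappings k w')
wrappings-unique k []       = []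
wrappings-unique k (x ∷ ys) =
  Unique.map⁺ (λ {t} {u} eq → ++-cancelʳ (0 ∷ []) t u (∷-injectiveʳ (∷-injectiveʳ eq))) (gapFillings-unique x k ys)

length-wrappings : ∀ k m {w'} → IsDiagram (suc m) (2 + k) w' →
  length (wrappings k w') ≡
    (if loops w' <ᵇ suc k then ((2 + k) * suc m ∸ loops w' ∸ 1) C (k ∸ loops w') else 0)
length-wrappings k m {[]} D with IsDiagram.length≡ D
... | ()
length-wrappings k m {x ∷ ys} D with loops (x ∷ ys) <ᵇ suc k in ℓ<?
... | true = begin
    length (map _ (gapFillings x k ys))           ≡⟨ length-map _ (gapFillings x k ys) ⟩
    length (gapFillings x k ys)                   ≡⟨ cong (λ j → length (gapFillings x j ys)) (m+[n∸m]≡n ℓ≤k) ⟨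
    length (gapFillings x (ℓ + (k ∸ ℓ)) ys)       ≡⟨ length-gapFillings x (k ∸ ℓ) ys ⟩
    (length ys ∸ ℓ) C (k ∸ ℓ)                     ≡⟨ cong (_C (k ∸ ℓ)) length-ys ⟩
    ((2 + k) * suc m ∸ ℓ ∸ 1) C (k ∸ ℓ)           ∎
  where
  open ≡-Reasoning
  ℓ : ℕ
  ℓ = loops (x ∷ ys)
  ℓ≤k : ℓ ≤ k
  ℓ≤k = s≤s⁻¹ (<ᵇ⇒< ℓ (suc k) (subst T (sym ℓ<?) tt))
  length-ys : length ys ∸ ℓ ≡ (2 + k) * suc m ∸ ℓ ∸ 1
  length-ys = begin
    suc (length ys) ∸ suc ℓ         ≡⟨ cong₂ _∸_ (IsDiagram.length≡ D) (+-comm 1 ℓ) ⟩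
    suc m * (2 + k) ∸ (ℓ + 1)       ≡⟨ cong (_∸ (ℓ + 1)) (*-comm (suc m) (2 + k)) ⟩
    (2 + k) * suc m ∸ (ℓ + 1)       ≡⟨ ∸-+-assoc ((2 + k) * suc m) ℓ 1 ⟨
    (2 + k) * suc m ∸ ℓ ∸ 1         ∎
... | false = trans (length-map _ (gapFillings x k ys)) (length-gapFillings-< x k ys k<ℓ)
  where
  k<ℓ : k < loops (x ∷ ys)
  k<ℓ = ≮⇒≥ (λ ℓ<1+k → subst T ℓ<? (<⇒<ᵇ ℓ<1+k))

count-wrapsAround : ∀ k m → count wrapsAround (diagrams (2 + m) (2 + k)) ≡ correction (2 + k) (2 + m)
count-wrapsAround k m = begin
    count wrapsAround (diagrams (2 + m) d)
      ≡⟨ unique-length-≡ (Unique.filter⁺ _ (diagrams-unique (2 + m) d))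
           (concatMap-unique (wrappings k) deleteBlock₀ (λ {w'} → deleteBlock₀-wrappings k w')
              (wrappings-unique k) D' (diagrams-unique (suc m) d))
           wrapping⁺ wrapping⁻ ⟩
    length (concatMap (wrappings k) D')
      ≡⟨ length-concatMap (wrappings k) D' ⟩
    sum (map (length ∘ wrappings k) D')
      ≡⟨ sum-map-cong _ _ D' (λ w' w'∈ → length-wrappings k m (∈-diagrams⁻ (suc m) d w'∈)) ⟩
    sum (map (λ w' → if loops w' <ᵇ suc k then c (loops w') else 0) D')
      ≡⟨ sum-by-value c loops (suc k) D' ⟨
    correction d (2 + m) ∎
  where
  open ≡-Reasoning
  d : ℕ
  d = 2 + k
  D' : List (List ℕ)
  D' = diagrams (suc m) d
  c : ℕ → ℕ
  c ℓ = (d * suc m ∸ ℓ ∸ 1) C (k ∸ ℓ)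
  wrapping⁺ : ∀ {w} → w ∈ filter (λ w → T? (wrapsAround w)) (diagrams (2 + m) d) →
    w ∈ concatMap (wrappings k) D'
  wrapping⁺ w∈ with ∈-filter⁻ (λ w → T? (wrapsAround w)) {xs = diagrams (2 + m) d} w∈
  ... | w∈D , wraps = ∈-wrappings⁺ k (suc m) (∈-diagrams⁻ (2 + m) d w∈D) wraps
  wrapping⁻ : ∀ {w} → w ∈ concatMap (wrappings k) D' →
    w ∈ filter (λ w → T? (wrapsAround w)) (diagrams (2 + m) d)
  wrapping⁻ w∈ with find (∈-concatMap⁻ (wrappings k) {xs = D'} w∈)
  ... | w' , w'∈ , w∈wrappings with ∈-wrappings⁻ k (suc m) (∈-diagrams⁻ (suc m) d w'∈) w∈wrappings
  ... | D , wraps = ∈-filter⁺ (λ w → T? (wrapsAround w)) (∈-diagrams⁺ (2 + m) d D) wraps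

cyclicLoopless⇒loopless : ∀ w → T (cyclicLoops w ≡ᵇ 0) → T (loops w ≡ᵇ 0)
cyclicLoopless⇒loopless []       _ = tt
cyclicLoopless⇒loopless (x ∷ xs) cyclicLoopless with loops (x ∷ xs)
... | zero = tt

+m≡+[m+n]-+n : ∀ m n → + m ≡ + (m + n) - + n
+m≡+[m+n]-+n m n = sym (begin
    + (m + n) - + n    ≡⟨ ℤ.[+m]-[+n]≡m⊖n (m + n) n ⟩
    (m + n) ⊖ n        ≡⟨ ℤ.⊖-≥ (m≤n+m n m) ⟩
    + (m + n ∸ n)      ≡⟨ cong +_ (m+n∸n≡m m n) ⟩
    + m                ∎)
  where open ≡-Reasoning

mainTheorem1 : (d n : ℕ) → 2 ≤ d → 2 ≤ n →
    + chordCount d n ≡ + linearCount d n 0 - + correction d n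
mainTheorem1 (suc (suc k)) (suc (suc m)) (s≤s (s≤s _)) (s≤s (s≤s _)) = begin
    + chordCount d n
      ≡⟨ +m≡+[m+n]-+n (chordCount d n) (correction d n) ⟩
    + (chordCount d n + correction d n) - + correction d n
      ≡⟨ cong (λ a → + (chordCount d n + a) - + correction d n) (count-wrapsAround k m) ⟨
    + (chordCount d n + count wrapsAround (diagrams n d)) - + correction d n
      ≡⟨ cong (λ a → + a - + correction d n)
           (count-split (λ w → loops w ≡ᵇ 0) (λ w → cyclicLoops w ≡ᵇ 0) cyclicLoopless⇒loopless (diagrams n d)) ⟨
    + linearCount d n 0 - + correction d n ∎
  where
  open ≡-Reasoning
  d n : ℕ
  d = 2 + k
  n = 2 + m
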